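{- Let $G$ be a finite simple connected graph on $\{1,\dots,\ell\}$, let $T$ be a minimal separator of $G$ and let $C$ be a connected component of $G\setminus T$ with $|C|=k$. Let $v_1,\dots,v_k$ be any ordering of the vertices of $C$, put $C_i=\{v_1,\dots,v_i\}$ and $T_i=\bigcup_{j=1}^i N(v_j)\setminus C_i$ for $1\le i\le k$, and $\theta_{C_i}^{T_i}=\sum_{j\in C_i}\prod_{t\in T_i}(x_j-x_t)\,D_j$. Then for every $p\in S[y]$ the derivation $\theta_C^{T,p}=\sum_{m\in C}\prod_{t\in T}(x_m-x_t)\,p(x_m)\,D_m$ lies in the $S$-submodule of $\mathrm{Der}_{\mathbb{K}}(S)$ generated by $\{\theta_{C_i}^{T_i}:1\le i\le k\}$.
   Context: Let $\mathbb{K}$ be a field, $S=\mathbb{K}[x_1,\dots,x_\ell]$, $D_i=\partial/\partial x_i$, $\mathrm{Der}_{\mathbb{K}}(S)$ the module of $\mathbb{K}$-derivations of $S$. $N(v)$ is the set of vertices adjacent to $v$. For vertices $a,b$, a set $T\subseteq V$ with $a,b\notin T$ is an $(a,b)$-separator if every $a$–$b$ path contains a vertex of $T$, and a minimal $(a,b)$-separator if no proper subset is an $(a,b)$-separator; $T$ is a minimal separator of $G$ if it is a minimal $(a,b)$-separator for some $a,b$. Components of $G\setminus T$ are identified with their vertex sets. $S[y]$ is the polynomial ring in $y$ over $S$ and $p(x_m)$ denotes substitution $y=x_m$. The family $(T_i,C_i)_{1\le i\le k}$ is called a descending chain of $(T,C)$. -}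

module Defs where

open import Level using (Level; _⊔_) renaming (zero to lzero)
open import Algebra.Bundles using (CommutativeRing)
open import Data.Nat using (ℕ; zero; suc)
import Data.Nat as Nat
open import Data.Fin using (Fin; zero; suc; toℕ; _≟_)
open import Data.Fin.Subset using (Subset; _∈_; _∉_; _⊂_)
open import Data.Bool using (Bool; true; false; if_then_else_; _∧_; _∨_; not)
open import Data.Vec using (lookup)
open import Data.Maybe using (Maybe; just; nothing)
open import Data.Product using (Σ; ∃; _×_; _,_)
open import Data.Unit using (⊤)
open import Relation.Nullary using (¬_)
open import Relation.Nullary.Decidable using (⌊_⌋)
open import Relation.Binary.PropositionalEquality using (_≡_)

record IsField {c r : Level} (R : CommutativeRing c r) : Set (c ⊔ r) where
  open CommutativeRing R
  field
    1≉0     : ¬ (1# ≈ 0#)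
    inverse : ∀ x → ¬ (x ≈ 0#) → Σ Carrier λ y → (x * y) ≈ 1#

-- Polynomial rings K[V]: the free commutative K-algebra on the set of
-- variables V, i.e. polynomial expressions modulo the commutative
-- K-algebra axioms.

module Poly {c r : Level} (R : CommutativeRing c r) where
  open CommutativeRing R using (_≈_; _+_; _*_; 0#; 1#) renaming (Carrier to K)

  infixl 6 _⊕_
  infixl 7 _⊗_
  infix 4 _∼_

  data Expr (V : Set) : Set c where
    con  : K → Expr V
    var  : V → Expr V
    _⊕_  : Expr V → Expr V → Expr V
    _⊗_  : Expr V → Expr V → Expr V
    ⊝_   : Expr V → Expr V

  data _∼_ {V : Set} : Expr V → Expr V → Set (c ⊔ r) where
    ∼-refl  : ∀ {a} → a ∼ a
    ∼-sym   : ∀ {a b} → a ∼ b → b ∼ a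
    ∼-trans : ∀ {a b d} → a ∼ b → b ∼ d → a ∼ d
    ⊕-cong  : ∀ {a a' b b'} → a ∼ a' → b ∼ b' → a ⊕ b ∼ a' ⊕ b'
    ⊗-cong  : ∀ {a a' b b'} → a ∼ a' → b ∼ b' → a ⊗ b ∼ a' ⊗ b'
    ⊝-cong  : ∀ {a a'} → a ∼ a' → ⊝ a ∼ ⊝ a'
    ⊕-assoc : ∀ a b d → (a ⊕ b) ⊕ d ∼ a ⊕ (b ⊕ d)
    ⊕-comm  : ∀ a b → a ⊕ b ∼ b ⊕ a
    ⊕-idʳ   : ∀ a → a ⊕ con 0# ∼ a
    ⊕-invʳ  : ∀ a → a ⊕ (⊝ a) ∼ con 0#
    ⊗-assoc : ∀ a b d → (a ⊗ b) ⊗ d ∼ a ⊗ (b ⊗ d)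
    ⊗-comm  : ∀ a b → a ⊗ b ∼ b ⊗ a
    ⊗-idʳ   : ∀ a → a ⊗ con 1# ∼ a
    ⊗-distribʳ : ∀ a b d → (a ⊕ b) ⊗ d ∼ (a ⊗ d) ⊕ (b ⊗ d)
    con-≈   : ∀ {x y} → x ≈ y → con x ∼ con y
    con-+   : ∀ x y → con (x + y) ∼ con x ⊕ con y
    con-*   : ∀ x y → con (x * y) ∼ con x ⊗ con y

  bind : {V W : Set} → Expr V → (V → Expr W) → Expr W
  bind (con x) σ = con x
  bind (var v) σ = σ v
  bind (a ⊕ b) σ = bind a σ ⊕ bind b σ
  bind (a ⊗ b) σ = bind a σ ⊗ bind b σ
  bind (⊝ a)   σ = ⊝ bind a σ

  sumF : {V : Set} {k : ℕ} → (Fin k → Expr V) → Expr V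
  sumF {k = zero}  f = con 0#
  sumF {k = suc k} f = f zero ⊕ sumF (λ i → f (suc i))

  prodF : {V : Set} {k : ℕ} → (Fin k → Expr V) → Expr V
  prodF {k = zero}  f = con 1#
  prodF {k = suc k} f = f zero ⊗ prodF (λ i → f (suc i))

  S : ℕ → Set c
  S n = Expr (Fin n)

  -- S[y]: the extra variable y is `nothing`
  Sy : ℕ → Set c
  Sy n = Expr (Maybe (Fin n))

  evalAt : {n : ℕ} → Sy n → Fin n → S n
  evalAt p m = bind p λ { nothing → var m ; (just i) → var i }

  -- Der_K(S) is the free S-module with basis D_1,…,D_n; a derivation
  -- Σ_j f_j D_j is represented by its coefficient vector j ↦ f_j.
  Der : ℕ → Set c
  Der n = Fin n → S n

  InSpan : {n k : ℕ} → Der n → (Fin k → Der n) → Set (c ⊔ r)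
  InSpan {n} {k} θ gens =
    Σ (Fin k → S n) λ f → ∀ j → θ j ∼ sumF (λ i → f i ⊗ gens i j)

  prodDiff : {n : ℕ} → (Fin n → Bool) → Fin n → S n
  prodDiff B m = prodF (λ t → if B t then var m ⊕ (⊝ var t) else con 1#)

  theta : {n : ℕ} → (Fin n → Bool) → (Fin n → Bool) → Der n
  theta A B m = if A m then prodDiff B m else con 0#

  thetaP : {n : ℕ} → (Fin n → Bool) → (Fin n → Bool) → Sy n → Der n
  thetaP A B p m = if A m then prodDiff B m ⊗ evalAt p m else con 0#

record SimpleGraph (n : ℕ) : Set where
  field
    adj    : Fin n → Fin n → Bool
    sym    : ∀ u v → adj u v ≡ adj v u
    irrefl : ∀ v → adj v v ≡ false

module _ {n : ℕ} (G : SimpleGraph n) where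
  open SimpleGraph G

  data WalkIn (allowed : Fin n → Set) : Fin n → Fin n → Set where
    stop : ∀ {a} → allowed a → WalkIn allowed a a
    step : ∀ {a b d} → allowed a → adj a b ≡ true → WalkIn allowed b d → WalkIn allowed a d

  Connected : Set
  Connected = ∀ a b → WalkIn (λ _ → ⊤) a b

  IsSeparator : Fin n → Fin n → Subset n → Set
  IsSeparator a b T = a ∉ T × b ∉ T × ¬ WalkIn (λ w → w ∉ T) a b

  IsMinimalSeparatorFor : Fin n → Fin n → Subset n → Set
  IsMinimalSeparatorFor a b T =
    IsSeparator a b T × (∀ T' → T' ⊂ T → ¬ IsSeparator a b T')

  IsMinimalSeparator : Subset n → Set
  IsMinimalSeparator T = ∃ λ a → ∃ λ b → IsMinimalSeparatorFor a b T

  IsComponent : Subset n → Subset n → Set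
  IsComponent T C =
      (∃ λ u → u ∈ C)
    × (∀ u → u ∈ C → u ∉ T)
    × (∀ u v → u ∈ C → (v ∈ C → WalkIn (λ w → w ∉ T) u v)
                       × (WalkIn (λ w → w ∉ T) u v → v ∈ C))

  anyF : {k : ℕ} → (Fin k → Bool) → Bool
  anyF {zero}  f = false
  anyF {suc k} f = f zero ∨ anyF (λ i → f (suc i))

  -- for an ordering v_1,…,v_k and index i (0-based, i.e. i+1 in the paper):
  -- C_i = {v_1,…,v_i}
  inCi : {k : ℕ} → (Fin k → Fin n) → Fin k → Fin n → Bool
  inCi v i u = anyF (λ j → ⌊ toℕ j Nat.≤? toℕ i ⌋ ∧ ⌊ v j ≟ u ⌋)

  inTi : {k : ℕ} → (Fin k → Fin n) → Fin k → Fin n → Bool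
  inTi v i t = anyF (λ j → ⌊ toℕ j Nat.≤? toℕ i ⌋ ∧ adj (v j) t) ∧ not (inCi v i t)

mem : {n : ℕ} → Subset n → Fin n → Bool
mem A u = lookup A u

{-# OPTIONS --safe #-}

-- Induction along the chain C₁ ⊂ ⋯ ⊂ C_k = C, for all p at once. Passing from C_{ℓ-1} to
-- C_ℓ = C_{ℓ-1} ∪ {a}, divide p by y − x_a: p(x_m) = p(x_a) + (x_m − x_a) p′(x_m). The first
-- summand contributes p(x_a) θ_{C_ℓ}^{T_ℓ}. In the second the coefficient of D_a vanishes, and
-- since T_{ℓ-1} ⊆ T_ℓ ∪ {a} the factor (x_m − x_a) ∏_{t ∈ T_ℓ} (x_m − x_t) equals
-- ∏_{t ∈ T_{ℓ-1}} (x_m − x_t) times a polynomial in x_m; so that summand is θ_{C_{ℓ-1}}^{T_{ℓ-1}, p″} for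
-- some p″, in the span by induction. At the end T_k ⊆ T, because a neighbour of C outside T
-- would lie in the component C, so θ_C^{T,p} = θ_{C_k}^{T_k, p ∏_{t ∈ T ∖ T_k} (y − x_t)}.

module Submission where

open import Defs
open import Level using (Level; _⊔_)
open import Algebra.Bundles using (CommutativeRing)
open import Data.Bool using (Bool; true; false; T; if_then_else_; _∧_; not)
open import Data.Bool.Properties using (T-∧; T-∨; T-≡)
open import Data.Empty using (⊥-elim)
open import Data.Fin using (Fin; zero; suc; toℕ; fromℕ<; _≟_)
open import Data.Fin.Properties using (toℕ-injective; toℕ<n; toℕ-fromℕ<)
open import Data.Fin.Subset using (Subset; _∈_; ∣_∣)
open import Data.Maybe using (just; nothing)
open import Data.Nat using (ℕ; zero; suc; _≤_; _<_; _≤?_; s≤s)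
open import Data.Nat.Properties using (≤-refl; <⇒≤; m<n⇒m<1+n; m≤n⇒m<n∨m≡n)
open import Data.Product using (∃; _×_; _,_; proj₁; proj₂)
open import Data.Sum using (inj₁; inj₂; [_,_]′; map₂)
open import Data.Vec.Properties using (lookup⇒[]=; []=⇒lookup)
open import Function using (_∘_; Equivalence)
open import Function.Definitions using (Injective)
open import Relation.Binary.Bundles using (Setoid)
open import Relation.Binary.PropositionalEquality using (_≡_; refl; sym; trans; cong; cong₂; subst)
open import Relation.Nullary using (¬_; does; yes; no; contradiction)
open import Relation.Nullary.Decidable using (⌊_⌋; toWitness; fromWitness; T?; dec-true)
open import Relation.Unary using (_⊆_; _∪_; ｛_｝)

open Equivalence using (to; from)

module PolynomialRing {c r : Level} (R : CommutativeRing c r) (V : Set) where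
  open Poly R
  open CommutativeRing R using (0#; 1#)

  setoid : Setoid c (c ⊔ r)
  setoid = record
    { Carrier       = Expr V
    ; _≈_           = _∼_
    ; isEquivalence = record { refl = ∼-refl ; sym = ∼-sym ; trans = ∼-trans }
    }

  open import Algebra.Consequences.Setoid setoid
    using (comm∧idʳ⇒id; comm∧invʳ⇒inv; comm∧distrʳ⇒distr)

  commutativeRing : CommutativeRing c (c ⊔ r)
  commutativeRing = record
    { isCommutativeRing = record
      { isRing = record
        { +-isAbelianGroup = record
          { isGroup = record
            { isMonoid = record
              { isSemigroup = record
                { isMagma = record { isEquivalence = Setoid.isEquivalence setoid ; ∙-cong = ⊕-cong }
                ; assoc   = ⊕-assoc
                }
              ; identity = comm∧idʳ⇒id ⊕-comm ⊕-idʳ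
              }
            ; inverse = comm∧invʳ⇒inv ⊕-comm ⊕-invʳ
            ; ⁻¹-cong = ⊝-cong
            }
          ; comm = ⊕-comm
          }
        ; *-cong     = ⊗-cong
        ; *-assoc    = ⊗-assoc
        ; *-identity = comm∧idʳ⇒id ⊗-comm ⊗-idʳ
        ; distrib    = comm∧distrʳ⇒distr ⊕-cong ⊗-comm (λ x y z → ⊗-distribʳ y z x)
        }
      ; *-comm = ⊗-comm
      }
    }

  open CommutativeRing commutativeRing
    using ( +-identityˡ; +-identityʳ; *-identityˡ; *-identityʳ; zeroˡ
          ; +-commutativeSemigroup; *-commutativeSemigroup )
  open import Algebra.Properties.CommutativeSemigroup +-commutativeSemigroup
    using () renaming (interchange to ⊕-interchange)
  open import Algebra.Properties.CommutativeSemigroup *-commutativeSemigroup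
    using () renaming (interchange to ⊗-interchange)

  open import Algebra.Solver.Ring.NaturalCoefficients.Default
    (CommutativeRing.commutativeSemiring commutativeRing) public
    using (solve; _:=_; _:+_; _:*_)

  sumF-cong : ∀ {k} {f g : Fin k → Expr V} → (∀ i → f i ∼ g i) → sumF f ∼ sumF g
  sumF-cong {zero}  f≈g = ∼-refl
  sumF-cong {suc k} f≈g = ⊕-cong (f≈g zero) (sumF-cong (f≈g ∘ suc))

  sumF-distrib-⊕ : ∀ {k} (f g : Fin k → Expr V) → sumF (λ i → f i ⊕ g i) ∼ sumF f ⊕ sumF g
  sumF-distrib-⊕ {zero}  f g = ∼-sym (+-identityʳ _)
  sumF-distrib-⊕ {suc k} f g =
    ∼-trans (⊕-cong ∼-refl (sumF-distrib-⊕ (f ∘ suc) (g ∘ suc))) (⊕-interchange _ _ _ _)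

  sumF-0 : ∀ {k} {f : Fin k → Expr V} → (∀ i → f i ∼ con 0#) → sumF f ∼ con 0#
  sumF-0 {zero}  f≈0 = ∼-refl
  sumF-0 {suc k} f≈0 = ∼-trans (⊕-cong (f≈0 zero) (sumF-0 (f≈0 ∘ suc))) (+-identityʳ _)

  sumF-select : ∀ {k} (a : Fin k) (s : Expr V) (g : Fin k → Expr V) →
    sumF (λ i → (if does (i ≟ a) then s else con 0#) ⊗ g i) ∼ s ⊗ g a
  sumF-select zero    s g = ∼-trans (⊕-cong ∼-refl (sumF-0 (λ i → zeroˡ _))) (+-identityʳ _)
  sumF-select (suc a) s g =
    ∼-trans (⊕-cong (zeroˡ _) ∼-refl) (∼-trans (+-identityˡ _) (sumF-select a s (g ∘ suc)))

  prodF-cong : ∀ {k} {f g : Fin k → Expr V} → (∀ i → f i ∼ g i) → prodF f ∼ prodF g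
  prodF-cong {zero}  f≈g = ∼-refl
  prodF-cong {suc k} f≈g = ⊗-cong (f≈g zero) (prodF-cong (f≈g ∘ suc))

  prodF-distrib-⊗ : ∀ {k} (f g : Fin k → Expr V) → prodF (λ i → f i ⊗ g i) ∼ prodF f ⊗ prodF g
  prodF-distrib-⊗ {zero}  f g = ∼-sym (*-identityʳ _)
  prodF-distrib-⊗ {suc k} f g =
    ∼-trans (⊗-cong ∼-refl (prodF-distrib-⊗ (f ∘ suc) (g ∘ suc))) (⊗-interchange _ _ _ _)

  prodF-1 : ∀ {k} {f : Fin k → Expr V} → (∀ i → f i ∼ con 1#) → prodF f ∼ con 1#
  prodF-1 {zero}  f≈1 = ∼-refl
  prodF-1 {suc k} f≈1 = ∼-trans (⊗-cong (f≈1 zero) (prodF-1 (f≈1 ∘ suc))) (*-identityʳ _)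

  prodF-select : ∀ {k} (a : Fin k) (g : Fin k → Expr V) →
    prodF (λ i → if does (i ≟ a) then g i else con 1#) ∼ g a
  prodF-select zero    g = ∼-trans (⊗-cong ∼-refl (prodF-1 (λ _ → ∼-refl))) (*-identityʳ _)
  prodF-select (suc a) g = ∼-trans (*-identityˡ _) (prodF-select a (g ∘ suc))

module Substitution {c r : Level} (R : CommutativeRing c r) where
  open Poly R

  bind-cong : ∀ {V W} (e : Expr V) {σ τ : V → Expr W} → (∀ x → σ x ≡ τ x) → bind e σ ≡ bind e τ
  bind-cong (con x) σ≗τ = refl
  bind-cong (var x) σ≗τ = σ≗τ x
  bind-cong (a ⊕ b) σ≗τ = cong₂ _⊕_ (bind-cong a σ≗τ) (bind-cong b σ≗τ)
  bind-cong (a ⊗ b) σ≗τ = cong₂ _⊗_ (bind-cong a σ≗τ) (bind-cong b σ≗τ)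
  bind-cong (⊝ a)   σ≗τ = cong ⊝_ (bind-cong a σ≗τ)

  bind-bind : ∀ {U V W} (e : Expr U) (σ : U → Expr V) (τ : V → Expr W) →
    bind (bind e σ) τ ≡ bind e (λ x → bind (σ x) τ)
  bind-bind (con x) σ τ = refl
  bind-bind (var x) σ τ = refl
  bind-bind (a ⊕ b) σ τ = cong₂ _⊕_ (bind-bind a σ τ) (bind-bind b σ τ)
  bind-bind (a ⊗ b) σ τ = cong₂ _⊗_ (bind-bind a σ τ) (bind-bind b σ τ)
  bind-bind (⊝ a)   σ τ = cong ⊝_ (bind-bind a σ τ)

  bind-prodF : ∀ {V W k} (f : Fin k → Expr V) (σ : V → Expr W) →
    bind (prodF f) σ ≡ prodF (λ t → bind (f t) σ)
  bind-prodF {k = zero}  f σ = refl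
  bind-prodF {k = suc k} f σ = cong (bind (f zero) σ ⊗_) (bind-prodF (f ∘ suc) σ)

module Derivations {c r : Level} (R : CommutativeRing c r) {n : ℕ} where
  open Poly R
  open CommutativeRing R using (0#; 1#)
  open Substitution R
  open PolynomialRing R (Fin n)
  open CommutativeRing commutativeRing
    using (+-identityʳ; *-identityˡ; *-identityʳ; zeroˡ; zeroʳ; *-assoc; *-comm; distribʳ)
  open import Algebra.Properties.AbelianGroup (CommutativeRing.+-abelianGroup commutativeRing)
    using (xyx⁻¹≈y; ⁻¹-∙-comm)
  open import Algebra.Properties.Ring (CommutativeRing.ring commutativeRing) using (-‿distribʳ-*)
  open import Relation.Binary.Reasoning.Setoid setoid

  ⁅_⁆ : Fin n → Fin n → Bool
  ⁅ a ⁆ t = does (t ≟ a)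

  ∅ : Fin n → Bool
  ∅ _ = false

  T-⁅⁆ : ∀ {a t} → a ≡ t → T (⁅ a ⁆ t)
  T-⁅⁆ {a} refl = T-≡ .from (dec-true (a ≟ a) refl)

  atVar : Fin n → Sy n → Sy n
  atVar a q = bind q λ { nothing → var (just a) ; (just i) → var (just i) }

  evalAt-atVar : ∀ a m (q : Sy n) → evalAt (atVar a q) m ≡ evalAt q a
  evalAt-atVar a m q = trans (bind-bind q _ _) (bind-cong q λ { nothing → refl ; (just _) → refl })

  -- (q(y) − q(x_a)) / (y − x_a); the product clause comes from
  -- pq − p(a)q(a) = (p − p(a)) q(a) + p (q − q(a))
  quotient : Fin n → Sy n → Sy n
  quotient a (con _)        = con 0#
  quotient a (var nothing)  = con 1#
  quotient a (var (just _)) = con 0#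
  quotient a (p ⊕ q)        = quotient a p ⊕ quotient a q
  quotient a (p ⊗ q)        = quotient a p ⊗ atVar a q ⊕ p ⊗ quotient a q
  quotient a (⊝ p)          = ⊝ quotient a p

  remainder-theorem : ∀ a m (q : Sy n) →
    evalAt q m ∼ evalAt q a ⊕ (var m ⊕ ⊝ var a) ⊗ evalAt (quotient a q) m
  remainder-theorem a m (con x)        = ∼-sym (∼-trans (⊕-cong ∼-refl (zeroʳ _)) (+-identityʳ _))
  remainder-theorem a m (var (just i)) = ∼-sym (∼-trans (⊕-cong ∼-refl (zeroʳ _)) (+-identityʳ _))
  remainder-theorem a m (var nothing)  = begin
    var m                                ≈⟨ xyx⁻¹≈y (var a) (var m) ⟨
    var a ⊕ var m ⊕ ⊝ var a              ≈⟨ ⊕-assoc _ _ _ ⟩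
    var a ⊕ (var m ⊕ ⊝ var a)            ≈⟨ ⊕-cong ∼-refl (*-identityʳ _) ⟨
    var a ⊕ (var m ⊕ ⊝ var a) ⊗ con 1#   ∎
  remainder-theorem a m (p ⊕ q) = ∼-trans
    (⊕-cong (remainder-theorem a m p) (remainder-theorem a m q))
    (solve 5 (λ A B C D d → (A :+ d :* B) :+ (C :+ d :* D) := (A :+ C) :+ d :* (B :+ D))
      ∼-refl _ _ _ _ _)
  remainder-theorem a m (⊝ p) = ∼-trans
    (⊝-cong (remainder-theorem a m p))
    (∼-trans (∼-sym (⁻¹-∙-comm _ _)) (⊕-cong ∼-refl (-‿distribʳ-* _ _)))
  remainder-theorem a m (p ⊗ q) = begin
    P ⊗ Q
      ≈⟨ ⊗-cong ∼-refl (remainder-theorem a m q) ⟩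
    P ⊗ (Qa ⊕ d ⊗ Q′)
      ≈⟨ solve 4 (λ P Qa d Q′ → P :* (Qa :+ d :* Q′) := P :* Qa :+ d :* (P :* Q′)) ∼-refl _ _ _ _ ⟩
    P ⊗ Qa ⊕ d ⊗ (P ⊗ Q′)
      ≈⟨ ⊕-cong (⊗-cong (remainder-theorem a m p) ∼-refl) ∼-refl ⟩
    (Pa ⊕ d ⊗ P′) ⊗ Qa ⊕ d ⊗ (P ⊗ Q′)
      ≈⟨ solve 6 (λ Pa d P′ Qa P Q′ → (Pa :+ d :* P′) :* Qa :+ d :* (P :* Q′)
                                     := Pa :* Qa :+ d :* (P′ :* Qa :+ P :* Q′)) ∼-refl _ _ _ _ _ _ ⟩
    Pa ⊗ Qa ⊕ d ⊗ (P′ ⊗ Qa ⊕ P ⊗ Q′)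
      ≡⟨ cong (λ x → Pa ⊗ Qa ⊕ d ⊗ (P′ ⊗ x ⊕ P ⊗ Q′)) (evalAt-atVar a m q) ⟨
    Pa ⊗ Qa ⊕ d ⊗ evalAt (quotient a (p ⊗ q)) m
      ∎
    where
    P = evalAt p m ; Q = evalAt q m ; Pa = evalAt p a ; Qa = evalAt q a
    P′ = evalAt (quotient a p) m ; Q′ = evalAt (quotient a q) m
    d = var m ⊕ ⊝ var a

  prodDiff-∅ : ∀ m → prodDiff ∅ m ∼ con 1#
  prodDiff-∅ m = prodF-1 (λ _ → ∼-refl)

  prodDiff-⁅⁆ : ∀ a m → prodDiff ⁅ a ⁆ m ∼ var m ⊕ ⊝ var a
  prodDiff-⁅⁆ a m = prodF-select a (λ t → var m ⊕ ⊝ var t)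

  y−x : Fin n → Sy n
  y−x t = var nothing ⊕ ⊝ var (just t)

  -- (y − x_t) ^ ([t ∈ B₁] + [t ∈ B₂] − [t ∈ B]), a polynomial as soon as B ⊆ B₁ ∪ B₂
  cofactorAt : (B B₁ B₂ : Fin n → Bool) → Fin n → Sy n
  cofactorAt B B₁ B₂ t with B t | B₁ t | B₂ t
  ... | true  | b₁    | b₂    = if b₁ ∧ b₂ then y−x t else con 1#
  ... | false | b₁    | b₂    = (if b₁ then y−x t else con 1#) ⊗ (if b₂ then y−x t else con 1#)

  cofactor : (B B₁ B₂ : Fin n → Bool) → Sy n
  cofactor B B₁ B₂ = prodF (cofactorAt B B₁ B₂)

  prodDiff-cover : ∀ {B B₁ B₂ : Fin n → Bool} → T ∘ B ⊆ T ∘ B₁ ∪ T ∘ B₂ → ∀ m →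
    prodDiff B₁ m ⊗ prodDiff B₂ m ∼ prodDiff B m ⊗ evalAt (cofactor B B₁ B₂) m
  prodDiff-cover {B} {B₁} {B₂} B⊆B₁∪B₂ m = begin
    prodDiff B₁ m ⊗ prodDiff B₂ m
      ≈⟨ prodF-distrib-⊗ _ _ ⟨
    prodF (λ t → x−x B₁ t ⊗ x−x B₂ t)
      ≈⟨ prodF-cong factorwise ⟩
    prodF (λ t → x−x B t ⊗ evalAt (cofactorAt B B₁ B₂ t) m)
      ≈⟨ prodF-distrib-⊗ _ _ ⟩
    prodDiff B m ⊗ prodF (λ t → evalAt (cofactorAt B B₁ B₂ t) m)
      ≡⟨ cong (prodDiff B m ⊗_) (bind-prodF _ _) ⟨
    prodDiff B m ⊗ evalAt (cofactor B B₁ B₂) m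
      ∎
    where
    x−x : (Fin n → Bool) → Fin n → S n
    x−x X t = if X t then var m ⊕ ⊝ var t else con 1#
    factorwise : ∀ t → x−x B₁ t ⊗ x−x B₂ t ∼ x−x B t ⊗ evalAt (cofactorAt B B₁ B₂ t) m
    factorwise t with B t | B₁ t | B₂ t | B⊆B₁∪B₂ {t}
    ... | true  | true  | true  | _ = ∼-refl
    ... | true  | true  | false | _ = ∼-refl
    ... | true  | false | true  | _ = ⊗-comm _ _
    ... | true  | false | false | cover with cover _
    ...   | inj₁ ()
    ...   | inj₂ ()
    factorwise t | false | true  | true  | _ = ∼-sym (*-identityˡ _)
    factorwise t | false | true  | false | _ = ∼-sym (*-identityˡ _)
    factorwise t | false | false | true  | _ = ∼-sym (*-identityˡ _)
    factorwise t | false | false | false | _ = ∼-sym (*-identityˡ _)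

  thetaP-cong : ∀ {A A′ : Fin n → Bool} B → (∀ m → A m ≡ A′ m) → ∀ p m →
    thetaP A B p m ∼ thetaP A′ B p m
  thetaP-cong B A≗A′ p m =
    Setoid.reflexive setoid (cong (λ b → if b then prodDiff B m ⊗ evalAt p m else con 0#) (A≗A′ m))

  thetaP-shrink : ∀ A {B B′ : Fin n → Bool} → T ∘ B ⊆ T ∘ B′ → ∀ p m →
    thetaP A B′ p m ∼ thetaP A B (cofactor B B′ ∅ ⊗ p) m
  thetaP-shrink A {B} {B′} B⊆B′ p m with A m
  ... | false = ∼-refl
  ... | true  = begin
    prodDiff B′ m ⊗ evalAt p m
      ≈⟨ ⊗-cong (*-identityʳ _) ∼-refl ⟨
    prodDiff B′ m ⊗ con 1# ⊗ evalAt p m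
      ≈⟨ ⊗-cong (⊗-cong ∼-refl (prodDiff-∅ m)) ∼-refl ⟨
    prodDiff B′ m ⊗ prodDiff ∅ m ⊗ evalAt p m
      ≈⟨ ⊗-cong (prodDiff-cover (inj₁ ∘ B⊆B′) m) ∼-refl ⟩
    prodDiff B m ⊗ evalAt (cofactor B B′ ∅) m ⊗ evalAt p m
      ≈⟨ *-assoc _ _ _ ⟩
    prodDiff B m ⊗ evalAt (cofactor B B′ ∅ ⊗ p) m
      ∎

  thetaP-extend : ∀ {A A′ B B′ : Fin n → Bool} a →
    T ∘ A ⊆ T ∘ A′ → T ∘ A′ ⊆ T ∘ A ∪ ｛ a ｝ → T ∘ B ⊆ T ∘ B′ ∪ ｛ a ｝ → ∀ q m →
    thetaP A′ B′ q m ∼ evalAt q a ⊗ theta A′ B′ m ⊕ thetaP A B (cofactor B B′ ⁅ a ⁆ ⊗ quotient a q) m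
  thetaP-extend {A} {A′} a A⊆A′ A′⊆A∪a B⊆B′∪a q m with A′ m | A m | A⊆A′ {m} | A′⊆A∪a {m}
  ... | false | false | _    | _       = ∼-sym (∼-trans (+-identityʳ _) (zeroʳ _))
  ... | false | true  | A⊆A′ | _       with () ← A⊆A′ _
  ... | true  | false | _    | A′⊆A∪a with A′⊆A∪a _
  ...   | inj₂ refl = ∼-trans (*-comm _ _) (∼-sym (+-identityʳ _))
  thetaP-extend {B = B} {B′} a _ _ B⊆B′∪a q m | true | true | _ | _ = begin
    P′ ⊗ evalAt q m
      ≈⟨ ⊗-cong ∼-refl (remainder-theorem a m q) ⟩
    P′ ⊗ (Qa ⊕ d ⊗ Q′)
      ≈⟨ solve 4 (λ P′ Qa d Q′ → P′ :* (Qa :+ d :* Q′) := Qa :* P′ :+ (P′ :* d) :* Q′) ∼-refl _ _ _ _ ⟩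
    Qa ⊗ P′ ⊕ (P′ ⊗ d) ⊗ Q′
      ≈⟨ ⊕-cong ∼-refl (⊗-cong (⊗-cong ∼-refl (prodDiff-⁅⁆ a m)) ∼-refl) ⟨
    Qa ⊗ P′ ⊕ (P′ ⊗ prodDiff ⁅ a ⁆ m) ⊗ Q′
      ≈⟨ ⊕-cong ∼-refl (⊗-cong (prodDiff-cover (map₂ T-⁅⁆ ∘ B⊆B′∪a) m) ∼-refl) ⟩
    Qa ⊗ P′ ⊕ (prodDiff B m ⊗ evalAt (cofactor B B′ ⁅ a ⁆) m) ⊗ Q′
      ≈⟨ ⊕-cong ∼-refl (*-assoc _ _ _) ⟩
    Qa ⊗ P′ ⊕ prodDiff B m ⊗ evalAt (cofactor B B′ ⁅ a ⁆ ⊗ quotient a q) m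
      ∎
    where
    P′ = prodDiff B′ m ; Qa = evalAt q a ; Q′ = evalAt (quotient a q) m
    d = var m ⊕ ⊝ var a

  module Span {k : ℕ} (gens : Fin k → Der n) where

    InSpan-cong : ∀ {θ θ′} → (∀ j → θ j ∼ θ′ j) → InSpan θ′ gens → InSpan θ gens
    InSpan-cong θ≈θ′ (f , θ′≈∑) = f , λ j → ∼-trans (θ≈θ′ j) (θ′≈∑ j)

    InSpan-0 : InSpan (λ _ → con 0#) gens
    InSpan-0 = (λ _ → con 0#) , λ j → ∼-sym (sumF-0 (λ i → zeroˡ _))

    InSpan-⊕ : ∀ {θ θ′} → InSpan θ gens → InSpan θ′ gens → InSpan (λ j → θ j ⊕ θ′ j) gens
    InSpan-⊕ (f , θ≈∑) (g , θ′≈∑) = (λ i → f i ⊕ g i) , λ j → ∼-trans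
      (⊕-cong (θ≈∑ j) (θ′≈∑ j))
      (∼-sym (∼-trans (sumF-cong (λ i → distribʳ _ _ _)) (sumF-distrib-⊕ _ _)))

    InSpan-gen : ∀ i s → InSpan (λ j → s ⊗ gens i j) gens
    InSpan-gen i s = (λ i′ → if does (i′ ≟ i) then s else con 0#) ,
                     λ j → ∼-sym (sumF-select i s (λ i′ → gens i′ j))

mem⁺ : ∀ {n} {A : Subset n} {u} → u ∈ A → T (mem A u)
mem⁺ u∈A = T-≡ .from ([]=⇒lookup u∈A)

mem⁻ : ∀ {n} {A : Subset n} {u} → T (mem A u) → u ∈ A
mem⁻ {A = A} {u} u∈A = lookup⇒[]= u A (T-≡ .to u∈A)

T-ext : ∀ {a b} → (T a → T b) → (T b → T a) → a ≡ b
T-ext {false} {false} _ _ = refl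
T-ext {false} {true}  _ b⇒a = contradiction _ b⇒a
T-ext {true}  {false} a⇒b _ = contradiction _ a⇒b
T-ext {true}  {true}  _ _ = refl

module DescendingChain {n : ℕ} (G : SimpleGraph n) {k : ℕ} (v : Fin k → Fin n) where
  open SimpleGraph G using (adj)

  anyF⁺ : ∀ {m} (f : Fin m → Bool) j → T (f j) → T (anyF G f)
  anyF⁺ f zero    fj = T-∨ .from (inj₁ fj)
  anyF⁺ f (suc j) fj = T-∨ {f zero} .from (inj₂ (anyF⁺ (f ∘ suc) j fj))

  anyF⁻ : ∀ {m} (f : Fin m → Bool) → T (anyF G f) → ∃ λ j → T (f j)
  anyF⁻ {suc m} f any with T-∨ {f zero} .to any
  ... | inj₁ f0 = zero , f0
  ... | inj₂ fs with anyF⁻ (f ∘ suc) fs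
  ...   | j , fj = suc j , fj

  -- chainC ℓ, chainT ℓ are the paper's C_ℓ, T_ℓ, with C₀ = T₀ = ∅;
  -- the 0-based inCi G v i and inTi G v i are chainC (suc (toℕ i)) and chainT (suc (toℕ i)).
  chainC : ℕ → Fin n → Bool
  chainC zero    u = false
  chainC (suc ℓ) u = anyF G (λ j → ⌊ toℕ j ≤? ℓ ⌋ ∧ ⌊ v j ≟ u ⌋)

  chainN : ℕ → Fin n → Bool
  chainN zero    t = false
  chainN (suc ℓ) t = anyF G (λ j → ⌊ toℕ j ≤? ℓ ⌋ ∧ adj (v j) t)

  chainT : ℕ → Fin n → Bool
  chainT ℓ t = chainN ℓ t ∧ not (chainC ℓ t)

  chainC⁺ : ∀ {ℓ} j → toℕ j < ℓ → T (chainC ℓ (v j))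
  chainC⁺ {suc ℓ} j (s≤s j≤ℓ) =
    anyF⁺ _ j (T-∧ {⌊ toℕ j ≤? ℓ ⌋} .from (fromWitness j≤ℓ , fromWitness refl))

  chainC⁻ : ∀ {ℓ u} → T (chainC ℓ u) → ∃ λ j → toℕ j < ℓ × v j ≡ u
  chainC⁻ {suc ℓ} u∈C with anyF⁻ _ u∈C
  ... | j , j∈C with T-∧ {⌊ toℕ j ≤? ℓ ⌋} .to j∈C
  ...   | j≤ℓ , vj≡u = j , s≤s (toWitness j≤ℓ) , toWitness vj≡u

  chainN⁺ : ∀ {ℓ t} j → toℕ j < ℓ → T (adj (v j) t) → T (chainN ℓ t)
  chainN⁺ {suc ℓ} j (s≤s j≤ℓ) vj~t =
    anyF⁺ _ j (T-∧ {⌊ toℕ j ≤? ℓ ⌋} .from (fromWitness j≤ℓ , vj~t))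

  chainN⁻ : ∀ {ℓ t} → T (chainN ℓ t) → ∃ λ j → toℕ j < ℓ × T (adj (v j) t)
  chainN⁻ {suc ℓ} t∈N with anyF⁻ _ t∈N
  ... | j , j∈N with T-∧ {⌊ toℕ j ≤? ℓ ⌋} .to j∈N
  ...   | j≤ℓ , vj~t = j , s≤s (toWitness j≤ℓ) , vj~t

  chainT⁺ : ∀ {ℓ t} → T (chainN ℓ t) → ¬ T (chainC ℓ t) → T (chainT ℓ t)
  chainT⁺ {ℓ} {t} t∈N t∉C with chainN ℓ t | chainC ℓ t
  ... | true | false = _
  ... | true | true  = t∉C _

  chainT⁻ : ∀ {ℓ t} → T (chainT ℓ t) → T (chainN ℓ t) × ¬ T (chainC ℓ t)
  chainT⁻ {ℓ} {t} t∈T with chainN ℓ t | chainC ℓ t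
  ... | true | false = _ , λ ()

  chainC-⊆-suc : ∀ {ℓ} → T ∘ chainC ℓ ⊆ T ∘ chainC (suc ℓ)
  chainC-⊆-suc {ℓ} {u} u∈C with chainC⁻ {u = u} u∈C
  ... | j , j<ℓ , refl = chainC⁺ j (m<n⇒m<1+n j<ℓ)

  chainN-⊆-suc : ∀ {ℓ} → T ∘ chainN ℓ ⊆ T ∘ chainN (suc ℓ)
  chainN-⊆-suc t∈N with chainN⁻ t∈N
  ... | j , j<ℓ , vj~t = chainN⁺ j (m<n⇒m<1+n j<ℓ) vj~t

  chainC-suc-⊆ : ∀ {ℓ} i → toℕ i ≡ ℓ → T ∘ chainC (suc ℓ) ⊆ T ∘ chainC ℓ ∪ ｛ v i ｝
  chainC-suc-⊆ i i≡ℓ {u} u∈C with chainC⁻ {u = u} u∈C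
  ... | j , s≤s j≤ℓ , refl with m≤n⇒m<n∨m≡n j≤ℓ
  ...   | inj₁ j<ℓ = inj₁ (chainC⁺ j j<ℓ)
  ...   | inj₂ j≡ℓ = inj₂ (cong v (toℕ-injective (trans i≡ℓ (sym j≡ℓ))))

  chainT-suc-⊆ : ∀ {ℓ} i → toℕ i ≡ ℓ → T ∘ chainT ℓ ⊆ T ∘ chainT (suc ℓ) ∪ ｛ v i ｝
  chainT-suc-⊆ {ℓ} i i≡ℓ {t} t∈T with chainT⁻ {ℓ} t∈T | T? (chainC (suc ℓ) t)
  ... | t∈N , t∉C | no t∉C′  = inj₁ (chainT⁺ {suc ℓ} (chainN-⊆-suc {ℓ} t∈N) t∉C′)
  ... | t∈N , t∉C | yes t∈C′ = [ ⊥-elim ∘ t∉C , inj₂ ]′ (chainC-suc-⊆ i i≡ℓ t∈C′)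

  Enumerates : Subset n → Set
  Enumerates C = ∀ u → (u ∈ C → ∃ λ j → v j ≡ u) × ((∃ λ j → v j ≡ u) → u ∈ C)

  chainC-enumerated : ∀ {C} → Enumerates C → ∀ u → chainC k u ≡ mem C u
  chainC-enumerated enum u = T-ext
    (λ u∈Cₖ → let j , _ , vj≡u = chainC⁻ {k} u∈Cₖ in mem⁺ (proj₂ (enum u) (j , vj≡u)))
    (λ u∈C → let j , vj≡u = proj₁ (enum u) (mem⁻ u∈C) in
             subst (T ∘ chainC k) vj≡u (chainC⁺ j (toℕ<n j)))

  chainT-⊆-separator : ∀ {Sep C} → IsComponent G Sep C → Enumerates C → T ∘ chainT k ⊆ T ∘ mem Sep
  chainT-⊆-separator {Sep} {C} (_ , C∩Sep≡∅ , C-closed) enum {t} t∈Tₖ with T? (mem Sep t)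
  ... | yes t∈Sep = t∈Sep
  ... | no  t∉Sep with chainT⁻ {k} t∈Tₖ
  ...   | t∈N , t∉Cₖ with chainN⁻ {k} t∈N
  ...     | j , _ , vj~t = ⊥-elim (t∉Cₖ (subst T (sym (chainC-enumerated enum t)) (mem⁺ t∈C)))
    where
    vj∈C : v j ∈ C
    vj∈C = proj₂ (enum (v j)) (j , refl)
    t∈C : t ∈ C
    t∈C = proj₂ (C-closed (v j) t vj∈C)
      (step (C∩Sep≡∅ (v j) vj∈C) (T-≡ .to vj~t) (stop (t∉Sep ∘ mem⁺)))

module ChainSpan {c r : Level} (R : CommutativeRing c r) {n : ℕ} (G : SimpleGraph n)
                 {k : ℕ} (v : Fin k → Fin n) where
  open Poly R
  open Derivations R
  open DescendingChain G v

  gens : Fin k → Der n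
  gens i = theta (inCi G v i) (inTi G v i)

  open Span gens

  gens-fromℕ< : ∀ {ℓ} (ℓ<k : ℓ < k) → gens (fromℕ< ℓ<k) ≡ theta (chainC (suc ℓ)) (chainT (suc ℓ))
  gens-fromℕ< ℓ<k = cong (λ ℓ → theta (chainC (suc ℓ)) (chainT (suc ℓ))) (toℕ-fromℕ< ℓ<k)

  chain-inSpan : ∀ ℓ → ℓ ≤ k → ∀ q → InSpan (thetaP (chainC ℓ) (chainT ℓ) q) gens
  chain-inSpan zero    _   q = InSpan-0
  chain-inSpan (suc ℓ) ℓ<k q = InSpan-cong
    (thetaP-extend (v i) (chainC-⊆-suc {ℓ}) (chainC-suc-⊆ i i≡ℓ) (chainT-suc-⊆ i i≡ℓ) q)
    (InSpan-⊕
      (subst (λ θ → InSpan (λ j → evalAt q (v i) ⊗ θ j) gens) (gens-fromℕ< ℓ<k) (InSpan-gen i _))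
      (chain-inSpan ℓ (<⇒≤ ℓ<k) (cofactor (chainT ℓ) (chainT (suc ℓ)) ⁅ v i ⁆ ⊗ quotient (v i) q)))
    where
    i = fromℕ< ℓ<k
    i≡ℓ = toℕ-fromℕ< ℓ<k

lemma3p11 : {c r : Level} (R : CommutativeRing c r) → IsField R →
    (n : ℕ) (G : SimpleGraph n) → Connected G →
    (T : Subset n) → IsMinimalSeparator G T →
    (C : Subset n) → IsComponent G T C →
    (k : ℕ) → k ≡ ∣ C ∣ →
    (v : Fin k → Fin n) → Injective _≡_ _≡_ v →
    (∀ u → (u ∈ C → ∃ λ j → v j ≡ u) × ((∃ λ j → v j ≡ u) → u ∈ C)) →
    (p : Poly.Sy R n) →
    Poly.InSpan R (Poly.thetaP R (mem C) (mem T) p)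
      (λ i → Poly.theta R (inCi G v i) (inTi G v i))
lemma3p11 R _ n G _ Sep _ C isComponent k _ v _ enum p =
  InSpan-cong (λ m → ∼-trans (thetaP-cong (mem Sep) (sym ∘ chainC-enumerated enum) p m)
                             (thetaP-shrink (chainC k) (chainT-⊆-separator isComponent enum) p m))
    (chain-inSpan k ≤-refl (cofactor (chainT k) (mem Sep) ∅ ⊗ p))
  where
  open Poly R
  open Derivations R
  open DescendingChain G v
  open ChainSpan R G v
  open Span gens
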